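{- Let $p$ and $k$ be integers with $p>5$ and $p+2\leq k<p^2-3p+2$. Define $f:\mathbb{Z}_{\geq 0}\to\mathbb{Z}_{\geq 0}$ by $$f(x)=\begin{cases}\dfrac{(x+p-1)(x+2p-1)}{p^2}, & x\equiv 1 \pmod p,\\[2mm] \dfrac{x+p-j}{p}, & x\equiv j \pmod p,\ 2\leq j\leq p-1,\\[2mm] \dfrac{x}{p}, & x\equiv 0\pmod p.\end{cases}$$ For a positive integer $n$ with base-$k$ expansion $n=a_{m-1}k^{m-1}+\dots+a_1k+a_0$ (digits $0\leq a_i<k$, $a_{m-1}\neq 0$), let $\mathcal{Z}_k(n)=\sum_{i=0}^{m-1}f(a_i)$, and set $n_j=\mathcal{Z}_k^{j}(n)$ for $j\geq 0$ (the $j$-fold iterate, $n_0=n$). Then for every positive integer $n$ there exists a finite positive integer $\lambda$ such that $n_\mu\in\{1,2\}$ for all $\mu\geq\lambda$.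
   Context: $\mathcal{Z}_k$ is called the $\mathcal{Z}$ transformation in base $k$ and $(n_j)_{j\ge0}$ the $\mathcal{Z}$ transformation sequence of $n$. Note that $f(1)=2$ and $f(2)=1$. -}

module Defs where

open import Data.Nat using (ℕ; zero; suc; _+_; _*_; _∸_; _≤_; _<_; NonZero)
open import Data.Nat.DivMod using (_/_; _%_)
open import Data.Nat.Properties using (_≟_; m*n≢0)
open import Function using (_∘_)
open import Relation.Nullary using (yes; no)

f : (p : ℕ) → .{{_ : NonZero p}} → ℕ → ℕ
f p {{nz}} x = go (x % p)
  where
  instance
    nzpp : NonZero (p * p)
    nzpp = m*n≢0 p p {{nz}} {{nz}}
  go : ℕ → ℕ
  go 0 = x / p
  go 1 = ((x + p ∸ 1) * (x + 2 * p ∸ 1)) / (p * p)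
  go (suc (suc j′)) = (x + p ∸ suc (suc j′)) / p

-- Sum of g over the base-k digits of m, with fuel (fuel ≥ m suffices for k ≥ 2).
digitSumAux : (k : ℕ) → .{{_ : NonZero k}} → (ℕ → ℕ) → ℕ → ℕ → ℕ
digitSumAux k g zero m = 0
digitSumAux k g (suc fuel) zero = 0
digitSumAux k g (suc fuel) (suc m) = g (suc m % k) + digitSumAux k g fuel (suc m / k)

Z : (p k : ℕ) → .{{_ : NonZero p}} → .{{_ : NonZero k}} → ℕ → ℕ
Z p k n = digitSumAux k (f p) n n

iter : (ℕ → ℕ) → ℕ → ℕ → ℕ
iter g zero n = n
iter g (suc j) n = g (iter g j n)

module Submission where

-- Idea: on a single base-k digit a (0 ≤ a < k) the map f satisfies
--   f a ≥ 1 for a ≥ 1,   f a ≤ a + 1,   f a < a for a ≥ 2,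
-- where the last bound on the residue class 1 (mod p) is exactly where the
-- hypothesis k + 3p < p² + 2 enters.  Summing over digits, any digit map g
-- with these three properties (and k ≥ 4) gives a digit sum D with
--   D m ≥ 1 for m ≥ 1,   D m < m for m ≥ 2,
-- since the higher digits of m contribute at most q + 1 to D while they
-- contribute q·k to m.  Finally, any map g on ℕ that is positive on positive
-- numbers, strictly decreasing from 2 on, and sends 1 to 2 (hence 2 to 1)
-- drives every positive n into {1, 2} by strong induction on n, and {1, 2}
-- is invariant.

open import Defs
open import Data.Nat using (ℕ; zero; suc; _+_; _*_; _∸_; _≤_; _<_; z≤n; s≤s; NonZero)
open import Data.Nat.Properties
open import Data.Nat.DivMod using (_/_; _%_; m≡m%n+[m/n]*n; m*n/n≡m; m<n⇒m%n≡m; m%n<n; m/n<m)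
open import Data.Nat.Induction using (<-rec)
open import Data.Nat.Tactic.RingSolver using (solve-∀)
open import Data.Product using (∃-syntax; _×_; _,_)
open import Data.Sum using (_⊎_; inj₁; inj₂)
open import Data.Empty using (⊥-elim)
open import Relation.Binary.PropositionalEquality
  using (_≡_; refl; sym; trans; cong; subst; module ≡-Reasoning)

iter-shift : (g : ℕ → ℕ) (μ n : ℕ) → iter g (suc μ) n ≡ iter g μ (g n)
iter-shift g zero    n = refl
iter-shift g (suc μ) n = cong g (iter-shift g μ n)

InCycle : ℕ → Set
InCycle n = n ≡ 1 ⊎ n ≡ 2

module Descent (g : ℕ → ℕ) (g-1 : g 1 ≡ 2)
  (g-pos : ∀ n → 1 ≤ n → 1 ≤ g n) (g-shrinks : ∀ n → 2 ≤ n → g n < n) where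

  g-2 : g 2 ≡ 1
  g-2 = ≤-antisym (≤-pred (g-shrinks 2 ≤-refl)) (g-pos 2 (s≤s z≤n))

  EventuallyInCycle : ℕ → Set
  EventuallyInCycle n = ∃[ λ′ ] (1 ≤ λ′ × ((μ : ℕ) → λ′ ≤ μ → InCycle (iter g μ n)))

  cycle-invariant : ∀ μ n → InCycle n → InCycle (iter g μ n)
  cycle-invariant zero    n c = c
  cycle-invariant (suc μ) n c with cycle-invariant μ n c
  ... | inj₁ e = inj₂ (trans (cong g e) g-1)
  ... | inj₂ e = inj₁ (trans (cong g e) g-2)

  delay : ∀ n → EventuallyInCycle (g n) → EventuallyInCycle n
  delay n (λ′ , _ , reach) = suc λ′ , s≤s z≤n , later
    where
    later : (μ : ℕ) → suc λ′ ≤ μ → InCycle (iter g μ n)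
    later (suc μ) (s≤s λ′≤μ) =
      subst InCycle (sym (iter-shift g μ n)) (reach μ λ′≤μ)

  -- Strong induction: n ≥ 2 reaches the cycle via the smaller g n ≥ 1.
  eventually-in-cycle : ∀ n → 1 ≤ n → EventuallyInCycle n
  eventually-in-cycle = <-rec (λ n → 1 ≤ n → EventuallyInCycle n) step
    where
    step : ∀ n → (∀ {m} → m < n → 1 ≤ m → EventuallyInCycle m) → 1 ≤ n → EventuallyInCycle n
    step (suc zero)    _  _   = 1 , s≤s z≤n , λ μ _ → cycle-invariant μ 1 (inj₁ refl)
    step (suc (suc m)) ih 1≤n = delay (suc (suc m))
      (ih (g-shrinks (suc (suc m)) (s≤s (s≤s z≤n))) (g-pos (suc (suc m)) 1≤n))

-- The higher digits q ≥ 1 of a number contribute q·k to it, which is at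
-- least 3 more than the bound q + 1 on their contribution to the digit sum.
higher-digits-dominate : ∀ k q .{{_ : NonZero k}} → 4 ≤ k → 1 ≤ q → 3 + q ≤ q * k
higher-digits-dominate k (suc q) 4≤k _ = +-mono-≤ 4≤k (m≤m*n q k)

module DigitSum (k : ℕ) .{{_ : NonZero k}} (4≤k : 4 ≤ k) (g : ℕ → ℕ)
  (g-pos : ∀ a → a < k → 1 ≤ a → 1 ≤ g a)
  (g-bounded : ∀ a → a < k → g a ≤ suc a)
  (g-shrinks : ∀ a → a < k → 2 ≤ a → g a < a) where

  D : ℕ → ℕ → ℕ
  D = digitSumAux k g

  D-zero : ∀ fuel → D fuel 0 ≡ 0
  D-zero zero       = refl
  D-zero (suc fuel) = refl

  peel-pos : ∀ fuel a q → a < k → 1 ≤ a + q * k → (1 ≤ q → 1 ≤ D fuel q) → 1 ≤ g a + D fuel q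
  peel-pos fuel a zero    a<k 1≤m _  = ≤-trans (g-pos a a<k (subst (1 ≤_) (+-identityʳ a) 1≤m)) (m≤m+n (g a) _)
  peel-pos fuel a (suc q) a<k _   ih = ≤-trans (ih (s≤s z≤n)) (m≤n+m _ (g a))

  peel-bounded : ∀ fuel a q → a < k → D fuel q ≤ suc q → g a + D fuel q ≤ suc (a + q * k)
  peel-bounded fuel a zero a<k _ rewrite D-zero fuel | +-identityʳ (g a) | +-identityʳ a = g-bounded a a<k
  peel-bounded fuel a q@(suc _) a<k ih = begin
    g a + D fuel q   ≤⟨ +-mono-≤ (g-bounded a a<k) ih ⟩
    suc a + suc q    ≤⟨ +-monoʳ-≤ (suc a) (≤-trans (m≤n+m (suc q) 2) (higher-digits-dominate k q 4≤k (s≤s z≤n))) ⟩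
    suc (a + q * k)  ∎
    where open ≤-Reasoning

  peel-shrinks : ∀ fuel a q → a < k → 2 ≤ a + q * k → D fuel q ≤ suc q → suc (g a + D fuel q) ≤ a + q * k
  peel-shrinks fuel a zero a<k 2≤m _ rewrite D-zero fuel | +-identityʳ (g a) | +-identityʳ a = g-shrinks a a<k 2≤m
  peel-shrinks fuel a q@(suc _) a<k _ ih = begin
    suc (g a + D fuel q)     ≤⟨ s≤s (+-mono-≤ (g-bounded a a<k) ih) ⟩
    suc (suc a + suc q)      ≡⟨ sym (+-suc (suc a) (suc q)) ⟩
    suc a + (2 + q)          ≡⟨ sym (+-suc a (2 + q)) ⟩
    a + (3 + q)              ≤⟨ +-monoʳ-≤ a (higher-digits-dominate k q 4≤k (s≤s z≤n)) ⟩
    a + q * k                ∎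
    where open ≤-Reasoning

  last-digit : ∀ m → suc m ≡ suc m % k + (suc m / k) * k
  last-digit m = m≡m%n+[m/n]*n (suc m) k

  fuel-suffices : ∀ fuel m → suc m ≤ suc fuel → suc m / k ≤ fuel
  fuel-suffices fuel m le = ≤-pred (≤-trans (m/n<m (suc m) k (≤-trans (s≤s (s≤s z≤n)) 4≤k)) le)

  D-bounded : ∀ fuel m → m ≤ fuel → D fuel m ≤ suc m
  D-bounded zero       m       _  = z≤n
  D-bounded (suc fuel) zero    _  = z≤n
  D-bounded (suc fuel) (suc m) le =
    subst (λ M → D (suc fuel) (suc m) ≤ suc M) (sym (last-digit m))
      (peel-bounded fuel _ _ (m%n<n (suc m) k) (D-bounded fuel _ (fuel-suffices fuel m le)))

  D-shrinks : ∀ fuel m → m ≤ fuel → 2 ≤ m → D fuel m < m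
  D-shrinks (suc fuel) (suc m) le 2≤m =
    subst (D (suc fuel) (suc m) <_) (sym (last-digit m))
      (peel-shrinks fuel _ _ (m%n<n (suc m) k) (subst (2 ≤_) (last-digit m) 2≤m)
        (D-bounded fuel _ (fuel-suffices fuel m le)))

  D-pos : ∀ fuel m → m ≤ fuel → 1 ≤ m → 1 ≤ D fuel m
  D-pos (suc fuel) (suc m) le 1≤m =
    peel-pos fuel _ _ (m%n<n (suc m) k) (subst (1 ≤_) (last-digit m) 1≤m)
      (D-pos fuel _ (fuel-suffices fuel m le))

residue-one-product : ∀ q p → (1 + q * p + p ∸ 1) * (1 + q * p + 2 * p ∸ 1) ≡ (suc q * suc (suc q)) * (p * p)
residue-one-product q p = product q p
  where
  product : ∀ q p → (q * p + p) * (q * p + 2 * p) ≡ (suc q * suc (suc q)) * (p * p)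
  product = solve-∀

-- On the residue class 1 the value (Q + 1)(Q + 2) stays below Qp, provided
-- Q ≥ 1, Q + 3 < p and p ≥ 6 (the case Q = 1 needs p ≥ 6 rather than p ≥ 5).
residue-one-small : ∀ Q p → 1 ≤ Q → 6 ≤ p → Q + 3 < p → suc Q * suc (suc Q) ≤ Q * p
residue-one-small (suc zero) p _ 6≤p _ = subst (6 ≤_) (sym (*-identityˡ p)) 6≤p
residue-one-small (suc (suc r)) p _ _ r+5<p = begin
  (3 + r) * (4 + r)        ≤⟨ m≤m+n _ r ⟩
  (3 + r) * (4 + r) + r    ≡⟨ product r ⟩
  (2 + r) * (6 + r)        ≤⟨ *-monoʳ-≤ (2 + r) (subst (λ t → 3 + t ≤ p) (+-comm r 3) r+5<p) ⟩
  (2 + r) * p              ∎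
  where
  open ≤-Reasoning
  product : ∀ r → (3 + r) * (4 + r) + r ≡ (2 + r) * (6 + r)
  product = solve-∀

module ResidueClasses (p : ℕ) .{{_ : NonZero p}} where

  instance
    p²-nonZero : NonZero (p * p)
    p²-nonZero = m*n≢0 p p

  f-multiple : ∀ x → x % p ≡ 0 → f p x ≡ x / p
  f-multiple x r≡0 rewrite r≡0 = refl

  f-one : ∀ x q → x % p ≡ 1 → x ≡ 1 + q * p → f p x ≡ suc q * suc (suc q)
  f-one x q r≡1 refl rewrite r≡1 =
    trans (cong (_/ (p * p)) (residue-one-product q p)) (m*n/n≡m _ (p * p))

  f-other : ∀ x j q → x % p ≡ 2 + j → x ≡ 2 + j + q * p → f p x ≡ suc q
  f-other x j q r≡j+2 refl rewrite r≡j+2 = begin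
    (2 + j + q * p + p ∸ (2 + j)) / p  ≡⟨ cong (λ t → (t ∸ (2 + j)) / p) (+-assoc (2 + j) (q * p) p) ⟩
    (2 + j + (q * p + p) ∸ (2 + j)) / p ≡⟨ cong (_/ p) (m+n∸m≡n (2 + j) (q * p + p)) ⟩
    (q * p + p) / p                     ≡⟨ cong (_/ p) (+-comm (q * p) p) ⟩
    suc q * p / p                       ≡⟨ m*n/n≡m (suc q) p ⟩
    suc q                               ∎
    where open ≡-Reasoning

  data Residue (x : ℕ) : Set where
    multiple : ∀ q   → x ≡ q * p         → f p x ≡ q                   → Residue x
    one      : ∀ q   → x ≡ 1 + q * p     → f p x ≡ suc q * suc (suc q) → Residue x
    other    : ∀ q j → x ≡ 2 + j + q * p → f p x ≡ suc q               → Residue x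

  residue : ∀ x → Residue x
  residue x = classify (x % p) refl
    where
    division : ∀ r → x % p ≡ r → x ≡ r + x / p * p
    division r e = trans (m≡m%n+[m/n]*n x p) (cong (_+ x / p * p) e)
    classify : ∀ r → x % p ≡ r → Residue x
    classify 0             e = multiple (x / p) (division 0 e) (f-multiple x e)
    classify 1             e = one (x / p) (division 1 e) (f-one x (x / p) e (division 1 e))
    classify (suc (suc j)) e = other (x / p) j (division (2 + j) e) (f-other x j (x / p) e (division (2 + j) e))

  f-pos : ∀ x → 1 ≤ x → 1 ≤ f p x
  f-pos x 1≤x with residue x
  ... | multiple zero    refl _ = ⊥-elim (1+n≰n 1≤x)
  ... | multiple (suc q) _ fx = subst (1 ≤_) (sym fx) (s≤s z≤n)
  ... | one q   _ fx          = subst (1 ≤_) (sym fx) (s≤s z≤n)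
  ... | other q j _ fx        = subst (1 ≤_) (sym fx) (s≤s z≤n)

module DigitBounds (p k : ℕ) .{{_ : NonZero p}} .{{_ : NonZero k}}
  (5<p : 5 < p) (k+3p<p²+2 : k + 3 * p < p * p + 2) where

  open ResidueClasses p

  -- A digit 1 + qp < k has q + 3 < p: this is where k + 3p < p² + 2 is used.
  quotient-bound : ∀ q → 1 + q * p < k → q + 3 < p
  quotient-bound q 1+qp<k = *-cancelʳ-< p (q + 3) p (begin-strict
    (q + 3) * p      ≡⟨ *-distribʳ-+ p q 3 ⟩
    q * p + 3 * p    <⟨ +-cancelˡ-< 2 _ _ (begin-strict
        2 + (q * p + 3 * p)  ≤⟨ +-monoˡ-≤ (3 * p) 1+qp<k ⟩
        k + 3 * p            <⟨ k+3p<p²+2 ⟩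
        p * p + 2            ≡⟨ +-comm (p * p) 2 ⟩
        2 + p * p            ∎) ⟩
    p * p            ∎)
    where open ≤-Reasoning

  f-shrinks : ∀ x → x < k → 2 ≤ x → f p x < x
  f-shrinks x x<k 2≤x with residue x
  ... | multiple zero    refl _  = ⊥-elim (1+n≰n (≤-trans 2≤x z≤n))
  ... | multiple (suc q) refl fx = subst (_< suc q * p) (sym fx) (+-mono-≤ (≤-trans (s≤s (s≤s z≤n)) 5<p) (m≤m*n q p))
  ... | one zero    refl _       = ⊥-elim (1+n≰n (≤-pred 2≤x))
  ... | one (suc q) refl fx      = subst (_< 1 + suc q * p) (sym fx)
          (s≤s (residue-one-small (suc q) p (s≤s z≤n) 5<p (quotient-bound (suc q) x<k)))
  ... | other q j refl fx        = subst (_< 2 + j + q * p) (sym fx) (s≤s (s≤s (≤-trans (m≤m*n q p) (m≤n+m (q * p) j))))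

  f-bounded : ∀ x → x < k → f p x ≤ suc x
  f-bounded x x<k with residue x
  ... | multiple q refl fx = subst (_≤ suc (q * p)) (sym fx) (≤-trans (m≤m*n q p) (n≤1+n _))
  ... | one zero refl fx   = ≤-reflexive fx
  ... | one (suc q) refl _ = ≤-trans (<⇒≤ (f-shrinks x x<k (s≤s (≤-trans (≤-trans (s≤s z≤n) 5<p) (m≤m+n p (q * p)))))) (n≤1+n x)
  ... | other q j refl _   = ≤-trans (<⇒≤ (f-shrinks x x<k (s≤s (s≤s z≤n)))) (n≤1+n x)

theorem1 : (p k : ℕ) → .{{_ : NonZero p}} → .{{_ : NonZero k}} →
    5 < p → p + 2 ≤ k → k + 3 * p < p * p + 2 →
    (n : ℕ) → 1 ≤ n →
    ∃[ λ′ ] (1 ≤ λ′ × ((μ : ℕ) → λ′ ≤ μ →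
      (iter (Z p k) μ n ≡ 1 ⊎ iter (Z p k) μ n ≡ 2)))
theorem1 p k 5<p p+2≤k k+3p<p²+2 = Descent.eventually-in-cycle (Z p k) Z-1 Z-pos Z-shrinks
  where
  open ResidueClasses p using (f-pos; f-one)
  open DigitBounds p k 5<p k+3p<p²+2 using (f-bounded; f-shrinks)

  1<p : 1 < p
  1<p = ≤-trans (s≤s (s≤s z≤n)) 5<p

  4≤k : 4 ≤ k
  4≤k = ≤-trans (≤-trans (s≤s (s≤s (s≤s (s≤s z≤n)))) 5<p) (≤-trans (m≤m+n p 2) p+2≤k)

  open DigitSum k 4≤k (f p) (λ a _ → f-pos a) f-bounded (λ a a<k → f-shrinks a a<k)

  Z-1 : Z p k 1 ≡ 2
  Z-1 = trans (+-identityʳ _) (trans (cong (f p) (m<n⇒m%n≡m (≤-trans (s≤s (s≤s z≤n)) 4≤k)))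
          (f-one 1 0 (m<n⇒m%n≡m 1<p) refl))

  Z-pos : ∀ n → 1 ≤ n → 1 ≤ Z p k n
  Z-pos n = D-pos n n ≤-refl

  Z-shrinks : ∀ n → 2 ≤ n → Z p k n < n
  Z-shrinks n = D-shrinks n n ≤-refl
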